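{- Let $N$ be a natural number and $A\subseteq{}^N2$. If $\|A\|_4=k+1>1$, then \[|A|\geq 2^N-\sum_{j=1}^{\lfloor N/k\rfloor}(-1)^{j-1}\binom{\lfloor N/k\rfloor}{j}2^{N-jk}.\]
   Context: $N$ is identified with $\{0,\ldots,N-1\}$. ${}^N2$ is the set of all functions $f:N\to\{0,1\}$; ${}^{\underline N}2$ is the set of all partial functions $\sigma$ with $\mathrm{dom}(\sigma)\subseteq N$ and values in $\{0,1\}$ (including the empty function). For $\sigma\in{}^{\underline N}2$, $[\sigma]=\{f\in{}^N2:\sigma\subseteq f\}$. For $A\subseteq{}^N2$, $\Delta(A)=\{\sigma\in{}^{\underline N}2:[\sigma]\cap A=\emptyset\text{ and }[\rho]\cap A\neq\emptyset\text{ for all }\rho\subsetneq\sigma\}$. For $\delta_1,\delta_2\subseteq{}^{\underline N}2$, $\delta_1\preceq\delta_2$ iff every $\sigma\in\delta_1$ has some $\rho\in\delta_2$ with $\rho\subseteq\sigma$. For $\delta\subseteq{}^{\underline N}2$, $\mathrm{hn}(\delta)$ is the maximum of $k+1$ over $k\in\{0,\ldots,N-1\}$ such that for every $\delta'\subseteq\delta$ there is $\delta''\subseteq\delta'$ whose elements have pairwise disjoint domains and $|\bigcup_{\sigma\in\delta''}\mathrm{dom}(\sigma)|\geq k|\delta'|$; $\mathrm{HN}(\delta)=\max\{\mathrm{hn}(\delta'):\delta'\subseteq{}^{\underline N}2,\ \delta\preceq\delta'\}$; $\|A\|_4=\mathrm{HN}(\Delta(A))$. -}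

module Defs where

open import Data.Nat using (ℕ; zero; suc; _+_; _*_; _∸_; _^_; _≤_; _<_)
open import Data.Nat.DivMod using (_/_)
open import Data.Nat.Combinatorics using (_C_)
open import Data.Integer as ℤ using (ℤ; +_; -_)
open import Data.Bool using (Bool; true; false; _∧_; _∨_; if_then_else_)
open import Data.Maybe using (Maybe; just; nothing; is-just)
open import Data.Fin using (Fin)
open import Data.Vec using (Vec; []; _∷_; lookup)
open import Data.List using (List; []; _∷_; map; concatMap; allFin)
open import Data.Bool.ListAction using (any)
open import Data.Product using (Σ; _×_; ∃)
open import Relation.Binary.PropositionalEquality using (_≡_; _≢_)
open import Relation.Nullary using (¬_)

allVecs : {X : Set} → List X → (n : ℕ) → List (Vec X n)
allVecs xs zero = [] ∷ []
allVecs xs (suc n) = concatMap (λ x → map (x ∷_) (allVecs xs n)) xs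

count : {X : Set} → (X → Bool) → List X → ℕ
count p [] = 0
count p (x ∷ xs) = if p x then suc (count p xs) else count p xs

-- ^N 2 : total functions N → {0,1}, as Vec Bool N
-- ^{\underline N} 2 : partial functions, as Vec (Maybe Bool) N
--   (nothing = undefined at that point)

Total : ℕ → Set
Total N = Vec Bool N

Partial : ℕ → Set
Partial N = Vec (Maybe Bool) N

allTotal : (N : ℕ) → List (Total N)
allTotal N = allVecs (true ∷ false ∷ []) N

allPartial : (N : ℕ) → List (Partial N)
allPartial N = allVecs (nothing ∷ just true ∷ just false ∷ []) N

TSet : ℕ → Set
TSet N = Total N → Bool

PSet : ℕ → Set
PSet N = Partial N → Bool

∣_∣T : {N : ℕ} → TSet N → ℕ
∣_∣T {N} A = count A (allTotal N)

∣_∣P : {N : ℕ} → PSet N → ℕ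
∣_∣P {N} δ = count δ (allPartial N)

_⊆S_ : {N : ℕ} → PSet N → PSet N → Set
δ₁ ⊆S δ₂ = ∀ σ → δ₁ σ ≡ true → δ₂ σ ≡ true

_∈dom_ : {N : ℕ} → Fin N → Partial N → Set
i ∈dom σ = is-just (lookup σ i) ≡ true

_⊑_ : {N : ℕ} → Partial N → Total N → Set
σ ⊑ f = ∀ i b → lookup σ i ≡ just b → lookup f i ≡ b

_⊆p_ : {N : ℕ} → Partial N → Partial N → Set
ρ ⊆p σ = ∀ i b → lookup ρ i ≡ just b → lookup σ i ≡ just b

_⊊p_ : {N : ℕ} → Partial N → Partial N → Set
ρ ⊊p σ = ρ ⊆p σ × ρ ≢ σ

_∈Δ_ : {N : ℕ} → Partial N → TSet N → Set
σ ∈Δ A = (∀ f → σ ⊑ f → A f ≡ false)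
       × (∀ ρ → ρ ⊊p σ → ∃ λ f → ρ ⊑ f × A f ≡ true)

_⪯_ : {N : ℕ} → (Partial N → Set) → PSet N → Set
_⪯_ {N} δ₁ δ₂ = ∀ σ → δ₁ σ → Σ (Partial N) λ ρ → δ₂ ρ ≡ true × ρ ⊆p σ

PairwiseDisjointDom : {N : ℕ} → PSet N → Set
PairwiseDisjointDom δ = ∀ σ τ → δ σ ≡ true → δ τ ≡ true → σ ≢ τ →
                        ∀ i → ¬ (i ∈dom σ × i ∈dom τ)

∣⋃dom∣ : {N : ℕ} → PSet N → ℕ
∣⋃dom∣ {N} δ = count (λ i → any (λ σ → δ σ ∧ is-just (lookup σ i)) (allPartial N)) (allFin N)

HnCond : {N : ℕ} → PSet N → ℕ → Set
HnCond {N} δ k = ∀ (δ' : PSet N) → δ' ⊆S δ →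
  Σ (PSet N) λ δ'' → δ'' ⊆S δ' × PairwiseDisjointDom δ'' × (k * ∣ δ' ∣P ≤ ∣⋃dom∣ δ'')

IsMax : (ℕ → Set) → ℕ → Set
IsMax P m = P m × (∀ j → P j → j ≤ m)

IsHn : {N : ℕ} → PSet N → ℕ → Set
IsHn {N} δ m = IsMax (λ j → Σ ℕ λ k → k < N × j ≡ suc k × HnCond δ k) m

IsHN : {N : ℕ} → (Partial N → Set) → ℕ → Set
IsHN {N} δ m = IsMax (λ j → Σ (PSet N) λ δ' → δ ⪯ δ' × IsHn δ' j) m

IsNorm4 : {N : ℕ} → TSet N → ℕ → Set
IsNorm4 A m = IsHN (λ σ → σ ∈Δ A) m

-- ⌊ n / k ⌋ (k = 0 gives 0; irrelevant since k ≥ 1 in the theorem)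
divFloor : ℕ → ℕ → ℕ
divFloor n zero = 0
divFloor n (suc k) = n / suc k

sumFrom1 : ℕ → (ℕ → ℤ) → ℤ
sumFrom1 zero f = + 0
sumFrom1 (suc m) f = sumFrom1 m f ℤ.+ f (suc m)

bound : ℕ → ℕ → ℤ
bound N k = + (2 ^ N) ℤ.- sumFrom1 m (λ j → (- + 1) ℤ.^ (j ∸ 1) ℤ.* + ((m C j) * 2 ^ (N ∸ j * k)))
  where m = divFloor N k

-- Let δ ⪰ Δ(A) witness ‖A‖₄ = k + 1. Every point outside A lies in a cube of δ, so |A| is at
-- least the number of points avoiding all cubes of δ. Give every cube of δ the demand k; then
-- hn(δ) ≥ k + 1 is a Hall-type condition: each subfamily demands at most as many coordinates as
-- its cubes fix. Under this condition a family of cubes with demands r is avoided by at least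
-- 2^N ∏ (1 − 2^−r) points, by induction on N along the first coordinate. If no subfamily becomes
-- deficient once that coordinate is deleted, both halves of the space inherit the condition.
-- Otherwise the deficient subfamilies all contain one cube fixing the coordinate; on one half
-- that cube survives with its demand lowered by one, on the other half it disappears, and
-- 2^(r+1) − 1 = 2 (2^r − 1) + 1 recombines the two bounds. Finally |δ| = t with t k ≤ N, so
-- t ≤ m = ⌊N/k⌋ and |A| ≥ 2^N (1 − 2^−k)^t ≥ 2^(N − m k) (2^k − 1)^m, which is the alternating
-- sum of the statement by the binomial theorem.

module Submission where

open import Defs
open import Data.Nat as ℕ using (ℕ; zero; suc)
import Data.Nat.Properties as ℕ
open import Relation.Binary.PropositionalEquality

-- The alternating sum as a binomial expansion

mersenne : ℕ → ℕ
mersenne zero = 0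
mersenne (suc r) = suc (2 ℕ.* mersenne r)

suc-mersenne : ∀ r → suc (mersenne r) ≡ 2 ℕ.^ r
suc-mersenne zero = refl
suc-mersenne (suc r) = trans (cong suc (sym (ℕ.+-suc (mersenne r) _))) (cong (2 ℕ.*_) (suc-mersenne r))

module AlternatingSum where

  open import Data.Nat using (_∸_)
  open import Data.Nat.Combinatorics using (_C_)
  open import Data.Integer using (ℤ; +_; -_; _+_; _-_; _*_; _^_)
  import Data.Integer.Properties as ℤ
  open import Data.Integer.Tactic.RingSolver using (solve-∀)
  open import Data.Fin using (toℕ)
  open import Function using (_∘_)
  open import Algebra.Bundles using (CommutativeSemiring)
  import Algebra.Properties.CommutativeSemiring.Binomial as Binomial
  import Algebra.Properties.Semiring.Exp as SemiringExp
  import Algebra.Properties.Semiring.Sum as SemiringSum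
  import Algebra.Properties.Semiring.Mult as SemiringMult
  open ≡-Reasoning

  sumFrom1-cong : ∀ m {f g : ℕ → ℤ} → (∀ j → j ℕ.< m → f (suc j) ≡ g (suc j)) → sumFrom1 m f ≡ sumFrom1 m g
  sumFrom1-cong zero eq = refl
  sumFrom1-cong (suc m) eq = cong₂ _+_ (sumFrom1-cong m (λ j j<m → eq j (ℕ.m<n⇒m<1+n j<m))) (eq m ℕ.≤-refl)

  sumFrom1-*ˡ : ∀ m c (f : ℕ → ℤ) → sumFrom1 m (λ j → c * f j) ≡ c * sumFrom1 m f
  sumFrom1-*ˡ zero c f = sym (ℤ.*-zeroʳ c)
  sumFrom1-*ˡ (suc m) c f = trans (cong (_+ c * f (suc m)) (sumFrom1-*ˡ m c f)) (sym (ℤ.*-distribˡ-+ c _ _))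

  sumFrom1-neg : ∀ m (f : ℕ → ℤ) → sumFrom1 m (λ j → - f j) ≡ - sumFrom1 m f
  sumFrom1-neg zero f = refl
  sumFrom1-neg (suc m) f = trans (cong (_+ - f (suc m)) (sumFrom1-neg m f)) (sym (ℤ.neg-distrib-+ (sumFrom1 m f) _))

  sumFrom1-suc : ∀ m (f : ℕ → ℤ) → sumFrom1 (suc m) f ≡ f 1 + sumFrom1 m (f ∘ suc)
  sumFrom1-suc zero f = trans (ℤ.+-identityˡ (f 1)) (sym (ℤ.+-identityʳ (f 1)))
  sumFrom1-suc (suc m) f = trans (cong (_+ f (suc (suc m))) (sumFrom1-suc m f)) (ℤ.+-assoc (f 1) _ _)

  pos-^ : ∀ a m → (+ a) ^ m ≡ + (a ℕ.^ m)
  pos-^ a zero = refl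
  pos-^ a (suc m) = trans (cong (+ a *_) (pos-^ a m)) (sym (ℤ.pos-* a (a ℕ.^ m)))

  module _ where
    open CommutativeSemiring ℤ.+-*-commutativeSemiring using (semiring)
    open SemiringExp semiring renaming (_^_ to _^ˢ_)
    open SemiringSum semiring using (sum; sum-cong-≗)
    open SemiringMult semiring using (_×_)

    ^ˢ≡^ : ∀ m x → x ^ˢ m ≡ x ^ m
    ^ˢ≡^ zero x = refl
    ^ˢ≡^ (suc m) x = cong (x *_) (^ˢ≡^ m x)

    ×≡* : ∀ n x → n × x ≡ + n * x
    ×≡* zero x = sym (ℤ.*-zeroˡ x)
    ×≡* (suc n) x = begin
      x + n × x         ≡⟨ cong (_+_ x) (×≡* n x) ⟩
      x + + n * x       ≡⟨ cong (_+ + n * x) (ℤ.*-identityˡ x) ⟨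
      + 1 * x + + n * x ≡⟨ ℤ.*-distribʳ-+ x (+ 1) (+ n) ⟨
      (+ 1 + + n) * x   ≡⟨ cong (_* x) (ℤ.pos-+ 1 n) ⟨
      + suc n * x       ∎

    sum≡sumFrom0 : ∀ n (g : ℕ → ℤ) → sum {suc n} (g ∘ toℕ) ≡ g 0 + sumFrom1 n g
    sum≡sumFrom0 zero g = refl
    sum≡sumFrom0 (suc n) g = cong (_+_ (g 0)) (trans (sum≡sumFrom0 n (g ∘ suc)) (sym (sumFrom1-suc n g)))

    binomial-theorem : ∀ m x y → let term = λ j → + (m C j) * (x ^ j * y ^ (m ∸ j)) in
                       (x + y) ^ m ≡ term 0 + sumFrom1 m term
    binomial-theorem m x y = begin
      (x + y) ^ m
        ≡⟨ ^ˢ≡^ m (x + y) ⟨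
      (x + y) ^ˢ m
        ≡⟨ Binomial.theorem ℤ.+-*-commutativeSemiring m x y ⟩
      sum {suc m} (λ i → (m C toℕ i) × (x ^ˢ toℕ i * y ^ˢ (m ∸ toℕ i)))
        ≡⟨ sum-cong-≗ {suc m} (λ i → semiring-term≡term (toℕ i)) ⟩
      sum {suc m} (term ∘ toℕ)
        ≡⟨ sum≡sumFrom0 m term ⟩
      term 0 + sumFrom1 m term ∎
      where
      term : ℕ → ℤ
      term j = + (m C j) * (x ^ j * y ^ (m ∸ j))
      semiring-term≡term : ∀ j → (m C j) × (x ^ˢ j * y ^ˢ (m ∸ j)) ≡ term j
      semiring-term≡term j = trans (×≡* (m C j) _) (cong₂ (λ a b → + (m C j) * (a * b)) (^ˢ≡^ j x) (^ˢ≡^ (m ∸ j) y))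

  exponent-split : ∀ N k m i → m ℕ.* k ℕ.≤ N → i ℕ.≤ m → N ∸ i ℕ.* k ≡ (N ∸ m ℕ.* k) ℕ.+ (m ∸ i) ℕ.* k
  exponent-split N k m i mk≤N i≤m = begin
    N ∸ i ℕ.* k                                   ≡⟨ cong (_∸ i ℕ.* k) (ℕ.m∸n+n≡m mk≤N) ⟨
    (N ∸ m ℕ.* k) ℕ.+ m ℕ.* k ∸ i ℕ.* k           ≡⟨ ℕ.+-∸-assoc (N ∸ m ℕ.* k) (ℕ.*-monoˡ-≤ k i≤m) ⟩
    (N ∸ m ℕ.* k) ℕ.+ (m ℕ.* k ∸ i ℕ.* k)         ≡⟨ cong ((N ∸ m ℕ.* k) ℕ.+_) (ℕ.*-distribʳ-∸ k m i) ⟨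
    (N ∸ m ℕ.* k) ℕ.+ (m ∸ i) ℕ.* k               ∎

  alternating-sum-closed-form : ∀ N k m → m ℕ.* k ℕ.≤ N →
    + (2 ℕ.^ N) - sumFrom1 m (λ j → (- + 1) ^ (j ∸ 1) * + ((m C j) ℕ.* 2 ℕ.^ (N ∸ j ℕ.* k)))
      ≡ + (2 ℕ.^ (N ∸ m ℕ.* k) ℕ.* mersenne k ℕ.^ m)
  alternating-sum-closed-form N k m mk≤N = begin
    + (2 ℕ.^ N) - sumFrom1 m summand                     ≡⟨ cong₂ _-_ first-term (sumFrom1-cong m later-terms) ⟩
    c * term 0 - sumFrom1 m (λ j → - (c * term j))       ≡⟨ cong (λ s → c * term 0 - s) (sumFrom1-neg m _) ⟩
    c * term 0 - - sumFrom1 m (λ j → c * term j)         ≡⟨ cong (_+_ (c * term 0)) (ℤ.neg-involutive _) ⟩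
    c * term 0 + sumFrom1 m (λ j → c * term j)           ≡⟨ cong (_+_ (c * term 0)) (sumFrom1-*ˡ m c term) ⟩
    c * term 0 + c * sumFrom1 m term                     ≡⟨ ℤ.*-distribˡ-+ c (term 0) _ ⟨
    c * (term 0 + sumFrom1 m term)                       ≡⟨ cong (c *_) (binomial-theorem m (- + 1) e) ⟨
    c * (- + 1 + e) ^ m                                  ≡⟨ cong (λ x → c * x ^ m) e-1 ⟩
    c * (+ mersenne k) ^ m                               ≡⟨ cong (c *_) (pos-^ (mersenne k) m) ⟩
    c * + (mersenne k ℕ.^ m)                             ≡⟨ ℤ.pos-* (2 ℕ.^ R) _ ⟨
    + (2 ℕ.^ R ℕ.* mersenne k ℕ.^ m)                     ∎
    where
    R = N ∸ m ℕ.* k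
    c = + (2 ℕ.^ R)
    e = + (2 ℕ.^ k)
    summand : ℕ → ℤ
    summand j = (- + 1) ^ (j ∸ 1) * + ((m C j) ℕ.* 2 ℕ.^ (N ∸ j ℕ.* k))
    term : ℕ → ℤ
    term j = + (m C j) * ((- + 1) ^ j * e ^ (m ∸ j))
    e^ : ∀ n → e ^ n ≡ + (2 ℕ.^ (n ℕ.* k))
    e^ n = trans (pos-^ (2 ℕ.^ k) n) (cong +_ (trans (ℕ.^-*-assoc 2 k n) (cong (2 ℕ.^_) (ℕ.*-comm k n))))
    e-1 : - + 1 + e ≡ + mersenne k
    e-1 = begin
      - + 1 + e                  ≡⟨ cong (λ x → - + 1 + + x) (suc-mersenne k) ⟨
      - + 1 + + suc (mersenne k) ≡⟨ cong (_+_ (- + 1)) (ℤ.pos-+ 1 (mersenne k)) ⟩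
      - + 1 + (+ 1 + + mersenne k) ≡⟨ solve-∀ ⟩
      + mersenne k               ∎
    first-term : + (2 ℕ.^ N) ≡ c * term 0
    first-term = begin
      + (2 ℕ.^ N)                          ≡⟨ cong (λ x → + (2 ℕ.^ x)) (ℕ.m∸n+n≡m mk≤N) ⟨
      + (2 ℕ.^ (R ℕ.+ m ℕ.* k))            ≡⟨ cong +_ (ℕ.^-distribˡ-+-* 2 R (m ℕ.* k)) ⟩
      + (2 ℕ.^ R ℕ.* 2 ℕ.^ (m ℕ.* k))      ≡⟨ ℤ.pos-* (2 ℕ.^ R) _ ⟩
      c * + (2 ℕ.^ (m ℕ.* k))              ≡⟨ cong (c *_) (e^ m) ⟨
      c * e ^ m                            ≡⟨ cong (c *_) (sym (trans (ℤ.*-identityˡ _) (ℤ.*-identityˡ _))) ⟩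
      c * term 0                           ∎
    later-terms : ∀ j → j ℕ.< m → summand (suc j) ≡ - (c * term (suc j))
    later-terms j j<m = begin
      s * + (b ℕ.* 2 ℕ.^ (N ∸ suc j ℕ.* k))          ≡⟨ cong (λ x → s * + (b ℕ.* 2 ℕ.^ x)) (exponent-split N k m (suc j) mk≤N j<m) ⟩
      s * + (b ℕ.* 2 ℕ.^ (R ℕ.+ P))                  ≡⟨ cong (λ x → s * + (b ℕ.* x)) (ℕ.^-distribˡ-+-* 2 R P) ⟩
      s * + (b ℕ.* (2 ℕ.^ R ℕ.* 2 ℕ.^ P))            ≡⟨ cong (s *_) (trans (ℤ.pos-* b _) (cong (+ b *_) (ℤ.pos-* (2 ℕ.^ R) _))) ⟩
      s * (+ b * (c * + (2 ℕ.^ P)))                  ≡⟨ rearrange s (+ b) c (+ (2 ℕ.^ P)) ⟩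
      - (c * (+ b * ((- + 1 * s) * + (2 ℕ.^ P))))    ≡⟨ cong (λ x → - (c * (+ b * ((- + 1 * s) * x)))) (e^ (m ∸ suc j)) ⟨
      - (c * term (suc j))                           ∎
      where
      s = (- + 1) ^ j
      b = m C (suc j)
      P = (m ∸ suc j) ℕ.* k
      rearrange : ∀ s b c p → s * (b * (c * p)) ≡ - (c * (b * ((- + 1 * s) * p)))
      rearrange = solve-∀

open AlternatingSum using (alternating-sum-closed-form)

open import Data.Nat using (_+_; _*_; _∸_; _^_; _≤_; _<_; z≤n; s≤s; _<ᵇ_; >-nonZero)
open import Data.Nat.Properties
open import Data.Nat.DivMod using (_/_; m*n/n≡m; /-monoˡ-≤; m/n*n≤m)
open import Data.Nat.Tactic.RingSolver using (solve-∀)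
import Data.Integer as ℤ
open import Data.Bool using (Bool; true; false; _∧_; _∨_; not; T?)
open import Data.Bool.Properties using (∨-identityʳ; ∨-zeroʳ; ∧-conicalˡ; ∧-conicalʳ; not-injective; T-≡)
import Data.Bool.Properties as Boolₚ
open import Data.Bool.ListAction using (any)
open import Data.Maybe using (just; nothing; is-just)
open import Data.Maybe.Properties using (just-injective)
import Data.Maybe.Properties as Maybeₚ
open import Data.List using (List; []; _∷_; _++_; map; length; allFin; tabulate; filterᵇ)
open import Data.List.Properties using (map-tabulate; map-++; map-∘; map-id; ++-identityʳ; length-map; length-tabulate)
open import Data.List.Relation.Unary.Any as Any using (here; there)
open import Data.List.Membership.Propositional using (_∈_)
open import Data.List.Membership.Propositional.Properties using (∈-map⁺; ∈-concatMap⁺; ∈-allFin; ∈-filter⁺; ∈-filter⁻)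
import Data.List.Membership.DecPropositional as DecMembership
open import Data.List.Relation.Binary.Sublist.Propositional using (_⊆_; []; _∷_; _∷ʳ_; ⊆-trans)
open import Data.List.Relation.Binary.Sublist.Propositional.Properties using (filter-⊆; []⊆-universal; Any-resp-⊆)
open import Data.Vec as Vec using (Vec; []; _∷_; tail; lookup)
open import Data.Vec.Properties using (lookup-map)
import Data.Vec.Properties as Vecₚ
open import Data.Fin using (Fin; zero; suc)
open import Data.Product using (Σ; _×_; _,_; proj₁; proj₂; map₁)
open import Data.Sum using (_⊎_; inj₁; inj₂)
open import Data.Empty using (⊥-elim)
open import Function using (_∘_; id)
open import Function.Bundles using (Equivalence)
open import Relation.Nullary using (Dec; yes; no; does; contradiction)
import Algebra.Properties.CommutativeSemigroup as CommutativeSemigroupProperties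

module +-CS = CommutativeSemigroupProperties +-commutativeSemigroup
module *-CS = CommutativeSemigroupProperties *-commutativeSemigroup

private
  variable
    X Y : Set
    N : ℕ

-- Counting with Boolean predicates

bit : Bool → ℕ
bit true = 1
bit false = 0

bit≤1 : ∀ b → bit b ≤ 1
bit≤1 true = ≤-refl
bit≤1 false = z≤n

bit-∨-+-bit : ∀ a b c → (c ≡ true → a ≡ true × b ≡ true) → bit (a ∨ b) + bit c ≤ bit a + bit b
bit-∨-+-bit true  b     false _ = s≤s z≤n
bit-∨-+-bit false b     false _ = ≤-reflexive (+-identityʳ (bit b))
bit-∨-+-bit a     b     true  c⇒a∧b with refl , refl ← c⇒a∧b refl = ≤-refl

not-antitone : ∀ {a b} → (b ≡ true → a ≡ true) → not a ≡ true → not b ≡ true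
not-antitone {false} {true} b⇒a _ with () ← b⇒a refl
not-antitone {false} {false} _ _ = refl

count-cons : (p : X → Bool) (x : X) (xs : List X) → count p (x ∷ xs) ≡ bit (p x) + count p xs
count-cons p x xs with p x
... | true = refl
... | false = refl

count-++ : (p : X → Bool) (xs ys : List X) → count p (xs ++ ys) ≡ count p xs + count p ys
count-++ p [] ys = refl
count-++ p (x ∷ xs) ys = begin
  count p (x ∷ xs ++ ys)                ≡⟨ count-cons p x (xs ++ ys) ⟩
  bit (p x) + count p (xs ++ ys)        ≡⟨ cong (bit (p x) +_) (count-++ p xs ys) ⟩
  bit (p x) + (count p xs + count p ys) ≡⟨ +-assoc (bit (p x)) _ _ ⟨
  bit (p x) + count p xs + count p ys   ≡⟨ cong (_+ count p ys) (count-cons p x xs) ⟨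
  count p (x ∷ xs) + count p ys         ∎
  where open ≡-Reasoning

count-map : (p : Y → Bool) (g : X → Y) (xs : List X) → count p (map g xs) ≡ count (p ∘ g) xs
count-map p g [] = refl
count-map p g (x ∷ xs) = trans (count-cons p (g x) (map g xs)) (trans (cong (bit (p (g x)) +_) (count-map p g xs))
                                                            (sym (count-cons (p ∘ g) x xs)))

count-+-mono : (p q p′ q′ : X → Bool) → (∀ x → bit (p x) + bit (q x) ≤ bit (p′ x) + bit (q′ x)) →
               ∀ xs → count p xs + count q xs ≤ count p′ xs + count q′ xs
count-+-mono p q p′ q′ pointwise [] = z≤n
count-+-mono p q p′ q′ pointwise (x ∷ xs) = begin
  count p (x ∷ xs) + count q (x ∷ xs)                         ≡⟨ cong₂ _+_ (count-cons p x xs) (count-cons q x xs) ⟩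
  (bit (p x) + count p xs) + (bit (q x) + count q xs)         ≡⟨ +-CS.interchange (bit (p x)) _ _ _ ⟩
  (bit (p x) + bit (q x)) + (count p xs + count q xs)         ≤⟨ +-mono-≤ (pointwise x) (count-+-mono p q p′ q′ pointwise xs) ⟩
  (bit (p′ x) + bit (q′ x)) + (count p′ xs + count q′ xs)     ≡⟨ +-CS.interchange (bit (p′ x)) _ _ _ ⟩
  (bit (p′ x) + count p′ xs) + (bit (q′ x) + count q′ xs)     ≡⟨ cong₂ _+_ (count-cons p′ x xs) (count-cons q′ x xs) ⟨
  count p′ (x ∷ xs) + count q′ (x ∷ xs)                       ∎
  where open ≤-Reasoning

count-mono : {p q : X → Bool} → (∀ x → p x ≡ true → q x ≡ true) → ∀ xs → count p xs ≤ count q xs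
count-mono p⇒q [] = z≤n
count-mono {p = p} {q} p⇒q (x ∷ xs) with p x in px | q x in qx
... | true  | true  = s≤s (count-mono p⇒q xs)
... | true  | false with () ← trans (sym (p⇒q x px)) qx
... | false | true  = m≤n⇒m≤1+n (count-mono p⇒q xs)
... | false | false = count-mono p⇒q xs

count-cong : {p q : X → Bool} → (∀ x → p x ≡ q x) → ∀ xs → count p xs ≡ count q xs
count-cong p≗q xs = ≤-antisym (count-mono (λ x → trans (sym (p≗q x))) xs) (count-mono (λ x → trans (p≗q x)) xs)

count≤length : (p : X → Bool) (xs : List X) → count p xs ≤ length xs
count≤length p [] = z≤n
count≤length p (x ∷ xs) = ≤-trans (≤-reflexive (count-cons p x xs)) (+-mono-≤ (bit≤1 (p x)) (count≤length p xs))

count≡length-filterᵇ : (p : X → Bool) (xs : List X) → count p xs ≡ length (filterᵇ p xs)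
count≡length-filterᵇ p [] = refl
count≡length-filterᵇ p (x ∷ xs) with p x
... | true = cong suc (count≡length-filterᵇ p xs)
... | false = count≡length-filterᵇ p xs

length≤count : {p : X → Bool} {ys xs : List X} → ys ⊆ xs → (∀ y → y ∈ ys → p y ≡ true) → length ys ≤ count p xs
length≤count [] _ = z≤n
length≤count {p = p} {xs = x ∷ xs} (x ∷ʳ ys⊆xs) all-p =
  ≤-trans (length≤count ys⊆xs all-p) (≤-trans (m≤n+m _ (bit (p x))) (≤-reflexive (sym (count-cons p x xs))))
length≤count {p = p} {y ∷ ys} (refl ∷ ys⊆xs) all-p rewrite all-p y (here refl) =
  s≤s (length≤count ys⊆xs (λ z z∈ys → all-p z (there z∈ys)))

count-allFin-suc : ∀ {N} (p : Fin (suc N) → Bool) → count p (allFin (suc N)) ≡ bit (p zero) + count (p ∘ suc) (allFin N)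
count-allFin-suc {N} p = begin
  count p (allFin (suc N))                      ≡⟨ count-cons p zero (tabulate suc) ⟩
  bit (p zero) + count p (tabulate suc)         ≡⟨ cong (λ xs → bit (p zero) + count p xs) (map-tabulate id suc) ⟨
  bit (p zero) + count p (map suc (allFin N))   ≡⟨ cong (bit (p zero) +_) (count-map p suc (allFin N)) ⟩
  bit (p zero) + count (p ∘ suc) (allFin N)     ∎
  where open ≡-Reasoning

any-map : (p : Y → Bool) (g : X → Y) (xs : List X) → any p (map g xs) ≡ any (p ∘ g) xs
any-map p g [] = refl
any-map p g (x ∷ xs) = cong (p (g x) ∨_) (any-map p g xs)

any-cong : {p q : X → Bool} → (∀ x → p x ≡ q x) → ∀ xs → any p xs ≡ any q xs
any-cong p≗q [] = refl
any-cong p≗q (x ∷ xs) = cong₂ _∨_ (p≗q x) (any-cong p≗q xs)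

∈⇒any : (p : X → Bool) {x : X} {xs : List X} → x ∈ xs → p x ≡ true → any p xs ≡ true
∈⇒any p (here refl) px rewrite px = refl
∈⇒any p {xs = y ∷ _} (there x∈xs) px rewrite ∈⇒any p x∈xs px = ∨-zeroʳ (p y)

any⇒∈ : (p : X → Bool) (xs : List X) → any p xs ≡ true → Σ X λ x → x ∈ xs × p x ≡ true
any⇒∈ p (x ∷ xs) any≡true with p x in px
... | true = x , here refl , px
... | false with y , y∈xs , py ← any⇒∈ p xs any≡true = y , there y∈xs , py

any-false⇒false : (p : X → Bool) {x : X} {xs : List X} → any p xs ≡ false → x ∈ xs → p x ≡ false
any-false⇒false p {x} any≡false x∈xs with p x in px
... | false = refl
... | true with () ← trans (sym (∈⇒any p x∈xs px)) any≡false

any-mono : {p q : X → Bool} → (∀ x → p x ≡ true → q x ≡ true) → ∀ xs → any p xs ≡ true → any q xs ≡ true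
any-mono p⇒q xs any-p with x , x∈xs , px ← any⇒∈ _ xs any-p = ∈⇒any _ x∈xs (p⇒q x px)

any-skip : (p : X → Bool) (xs : List X) (y : X) (ys : List X) → p y ≡ false → any p (xs ++ y ∷ ys) ≡ any p (xs ++ ys)
any-skip p [] y ys py rewrite py = refl
any-skip p (x ∷ xs) y ys py = cong (p x ∨_) (any-skip p xs y ys py)

-- Subfamilies selected by masks

-- Masks are not tied to a length: missing entries count as false, surplus entries are ignored.
Mask : Set
Mask = List Bool

select : Mask → List X → List X
select m [] = []
select [] (x ∷ xs) = []
select (true ∷ m) (x ∷ xs) = x ∷ select m xs
select (false ∷ m) (x ∷ xs) = select m xs

_∧ᵐ_ : Mask → Mask → Mask
[] ∧ᵐ m′ = []
(a ∷ m) ∧ᵐ [] = []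
(a ∷ m) ∧ᵐ (b ∷ m′) = (a ∧ b) ∷ (m ∧ᵐ m′)

_∨ᵐ_ : Mask → Mask → Mask
[] ∨ᵐ m′ = m′
(a ∷ m) ∨ᵐ [] = a ∷ m
(a ∷ m) ∨ᵐ (b ∷ m′) = (a ∨ b) ∷ (m ∨ᵐ m′)

_selects_ : Mask → ℕ → Bool
[] selects i = false
(b ∷ m) selects zero = b
(b ∷ m) selects suc i = m selects i

skipAt : ℕ → Mask → Mask
skipAt zero m = false ∷ m
skipAt (suc i) [] = false ∷ skipAt i []
skipAt (suc i) (b ∷ m) = b ∷ skipAt i m

resize : ℕ → Mask → Mask
resize zero m = []
resize (suc n) [] = false ∷ resize n []
resize (suc n) (b ∷ m) = b ∷ resize n m

select-[]ˡ : (xs : List X) → select [] xs ≡ []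
select-[]ˡ [] = refl
select-[]ˡ (x ∷ xs) = refl

select-map : (g : X → Y) (m : Mask) (xs : List X) → select m (map g xs) ≡ map g (select m xs)
select-map g m [] = refl
select-map g [] (x ∷ xs) = refl
select-map g (true ∷ m) (x ∷ xs) = cong (g x ∷_) (select-map g m xs)
select-map g (false ∷ m) (x ∷ xs) = select-map g m xs

select-resize : (m : Mask) (xs : List X) → select (resize (length xs) m) xs ≡ select m xs
select-resize m [] = refl
select-resize [] (x ∷ xs) = trans (select-resize [] xs) (select-[]ˡ xs)
select-resize (true ∷ m) (x ∷ xs) = cong (x ∷_) (select-resize m xs)
select-resize (false ∷ m) (x ∷ xs) = select-resize m xs

select-skipAt : (m : Mask) (xs : List X) (y : X) (ys : List X) →
                select (skipAt (length xs) m) (xs ++ y ∷ ys) ≡ select m (xs ++ ys)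
select-skipAt m [] y ys = refl
select-skipAt [] (x ∷ xs) y ys = trans (select-skipAt [] xs y ys) (select-[]ˡ (xs ++ ys))
select-skipAt (true ∷ m) (x ∷ xs) y ys = cong (x ∷_) (select-skipAt m xs y ys)
select-skipAt (false ∷ m) (x ∷ xs) y ys = select-skipAt m xs y ys

select-⊆ : (m : Mask) (xs : List X) → select m xs ⊆ xs
select-⊆ m [] = []
select-⊆ [] (x ∷ xs) = []⊆-universal (x ∷ xs)
select-⊆ (true ∷ m) (x ∷ xs) = refl ∷ select-⊆ m xs
select-⊆ (false ∷ m) (x ∷ xs) = x ∷ʳ select-⊆ m xs

any-select-∨ᵐ : (p : X → Bool) (m m′ : Mask) (xs : List X) →
                any p (select (m ∨ᵐ m′) xs) ≡ any p (select m xs) ∨ any p (select m′ xs)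
any-select-∨ᵐ p m m′ [] = refl
any-select-∨ᵐ p [] m′ (x ∷ xs) = refl
any-select-∨ᵐ p (a ∷ m) [] (x ∷ xs) = sym (∨-identityʳ _)
any-select-∨ᵐ p (true ∷ m) (true ∷ m′) (x ∷ xs) with p x
... | true = refl
... | false = any-select-∨ᵐ p m m′ xs
any-select-∨ᵐ p (true ∷ m) (false ∷ m′) (x ∷ xs) with p x
... | true = refl
... | false = any-select-∨ᵐ p m m′ xs
any-select-∨ᵐ p (false ∷ m) (true ∷ m′) (x ∷ xs) with p x
... | true = sym (∨-zeroʳ _)
... | false = any-select-∨ᵐ p m m′ xs
any-select-∨ᵐ p (false ∷ m) (false ∷ m′) (x ∷ xs) = any-select-∨ᵐ p m m′ xs

any-select-∧ᵐ : (p : X → Bool) (m m′ : Mask) (xs : List X) → any p (select (m ∧ᵐ m′) xs) ≡ true →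
                any p (select m xs) ≡ true × any p (select m′ xs) ≡ true
any-select-∧ᵐ p (true ∷ m) (true ∷ m′) (x ∷ xs) any≡true with p x
... | true = refl , refl
... | false = any-select-∧ᵐ p m m′ xs any≡true
any-select-∧ᵐ p (true ∷ m) (false ∷ m′) (x ∷ xs) any≡true with in-m , in-m′ ← any-select-∧ᵐ p m m′ xs any≡true
  rewrite in-m = ∨-zeroʳ (p x) , in-m′
any-select-∧ᵐ p (false ∷ m) (true ∷ m′) (x ∷ xs) any≡true with in-m , in-m′ ← any-select-∧ᵐ p m m′ xs any≡true
  rewrite in-m′ = in-m , ∨-zeroʳ (p x)
any-select-∧ᵐ p (false ∷ m) (false ∷ m′) (x ∷ xs) any≡true = any-select-∧ᵐ p m m′ xs any≡true

length-select-∧ᵐ : (m m′ : Mask) (xs : List X) → length (select (m ∧ᵐ m′) xs) ≤ length (select m xs)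
length-select-∧ᵐ m m′ [] = z≤n
length-select-∧ᵐ [] m′ (x ∷ xs) = z≤n
length-select-∧ᵐ (a ∷ m) [] (x ∷ xs) = z≤n
length-select-∧ᵐ (true ∷ m) (true ∷ m′) (x ∷ xs) = s≤s (length-select-∧ᵐ m m′ xs)
length-select-∧ᵐ (true ∷ m) (false ∷ m′) (x ∷ xs) = m≤n⇒m≤1+n (length-select-∧ᵐ m m′ xs)
length-select-∧ᵐ (false ∷ m) (b ∷ m′) (x ∷ xs) = length-select-∧ᵐ m m′ xs

selects⇒length-select : (m : Mask) (xs : List X) (y : X) (ys : List X) →
                         m selects length xs ≡ true → 0 < length (select m (xs ++ y ∷ ys))
selects⇒length-select (true ∷ m) [] y ys _ = s≤s z≤n
selects⇒length-select (true ∷ m) (x ∷ xs) y ys _ = s≤s z≤n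
selects⇒length-select (false ∷ m) (x ∷ xs) y ys sel = selects⇒length-select m xs y ys sel

length-select-∧ᵐ-≡⇒selects : (m m′ : Mask) (xs : List X) (y : X) (ys : List X) →
  length (select (m ∧ᵐ m′) (xs ++ y ∷ ys)) ≡ length (select m (xs ++ y ∷ ys)) →
  m selects length xs ≡ true → m′ selects length xs ≡ true
length-select-∧ᵐ-≡⇒selects (a ∷ m) [] xs y ys eq sel =
  ⊥-elim (<⇒≢ (selects⇒length-select (a ∷ m) xs y ys sel) (trans (cong length (sym (select-[]ˡ (xs ++ y ∷ ys)))) eq))
length-select-∧ᵐ-≡⇒selects (true ∷ m) (true ∷ m′) [] y ys eq sel = refl
length-select-∧ᵐ-≡⇒selects (true ∷ m) (true ∷ m′) (x ∷ xs) y ys eq sel =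
  length-select-∧ᵐ-≡⇒selects m m′ xs y ys (suc-injective eq) sel
length-select-∧ᵐ-≡⇒selects (true ∷ m) (false ∷ m′) [] y ys eq sel =
  ⊥-elim (<⇒≱ (≤-reflexive (sym eq)) (length-select-∧ᵐ m m′ ys))
length-select-∧ᵐ-≡⇒selects (true ∷ m) (false ∷ m′) (x ∷ xs) y ys eq sel =
  ⊥-elim (<⇒≱ (≤-reflexive (sym eq)) (length-select-∧ᵐ m m′ (xs ++ y ∷ ys)))
length-select-∧ᵐ-≡⇒selects (false ∷ m) (b ∷ m′) (x ∷ xs) y ys eq sel = length-select-∧ᵐ-≡⇒selects m m′ xs y ys eq sel

search-masks : (n : ℕ) (P : Mask → Bool) → (Σ Mask λ m → P m ≡ true) ⊎ (∀ m → P (resize n m) ≡ false)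
search-masks zero P with P [] in P[]
... | true = inj₁ ([] , P[])
... | false = inj₂ (λ _ → refl)
search-masks (suc n) P with search-masks n (P ∘ (true ∷_)) | search-masks n (P ∘ (false ∷_))
... | inj₁ (m , Pm) | _ = inj₁ (true ∷ m , Pm)
... | inj₂ _ | inj₁ (m , Pm) = inj₁ (false ∷ m , Pm)
... | inj₂ none-true | inj₂ none-false = inj₂ λ where
  [] → none-false []
  (true ∷ m) → none-true m
  (false ∷ m) → none-false m

split-at-selected : (p : X → Bool) (m : Mask) (xs : List X) → any p (select m xs) ≡ true →
  Σ (List X) λ ys → Σ X λ y → Σ (List X) λ zs →
    xs ≡ ys ++ y ∷ zs × m selects length ys ≡ true × p y ≡ true
split-at-selected p (true ∷ m) (x ∷ xs) any≡true with p x in px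
... | true = [] , x , xs , refl , refl , px
... | false
  with ys , y , zs , xs≡ , sel , py ← split-at-selected p m xs any≡true = x ∷ ys , y , zs , cong (x ∷_) xs≡ , sel , py
split-at-selected p (false ∷ m) (x ∷ xs) any≡true
  with ys , y , zs , xs≡ , sel , py ← split-at-selected p m xs any≡true = x ∷ ys , y , zs , cong (x ∷_) xs≡ , sel , py

-- Cubes and the points avoiding them

⋃domSize : List (Partial N) → ℕ
⋃domSize {N} σs = count (λ i → any (λ σ → is-just (lookup σ i)) σs) (allFin N)

usesHead : List (Partial (suc N)) → Bool
usesHead = any (λ σ → is-just (lookup σ zero))

lookup-tail : ∀ {A : Set} {n} (v : Vec A (suc n)) (i : Fin n) → lookup (tail v) i ≡ lookup v (suc i)
lookup-tail (x ∷ v) i = refl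

⋃domSize-suc : (σs : List (Partial (suc N))) → ⋃domSize σs ≡ bit (usesHead σs) + ⋃domSize (map tail σs)
⋃domSize-suc {N} σs = trans (count-allFin-suc (λ i → any (λ σ → is-just (lookup σ i)) σs)) (cong (bit (usesHead σs) +_)
  (count-cong (λ i → sym (trans (any-map _ tail σs) (any-cong (λ σ → cong is-just (lookup-tail σ i)) σs))) (allFin N)))

⋃domSize-submodular : (m m′ : Mask) (σs : List (Partial N)) →
  ⋃domSize (select (m ∨ᵐ m′) σs) + ⋃domSize (select (m ∧ᵐ m′) σs) ≤ ⋃domSize (select m σs) + ⋃domSize (select m′ σs)
⋃domSize-submodular {N} m m′ σs = count-+-mono _ _ _ _ pointwise (allFin N)
  where
  pointwise : ∀ i → let uses = λ m → any (λ σ → is-just (lookup σ i)) (select m σs) in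
              bit (uses (m ∨ᵐ m′)) + bit (uses (m ∧ᵐ m′)) ≤ bit (uses m) + bit (uses m′)
  pointwise i rewrite any-select-∨ᵐ (λ σ → is-just (lookup σ i)) m m′ σs =
    bit-∨-+-bit _ _ _ (any-select-∧ᵐ (λ σ → is-just (lookup σ i)) m m′ σs)

inCube : Partial N → Total N → Bool
inCube [] [] = true
inCube (nothing ∷ σ) (b ∷ f) = inCube σ f
inCube (just true ∷ σ) (b ∷ f) = b ∧ inCube σ f
inCube (just false ∷ σ) (b ∷ f) = not b ∧ inCube σ f

avoidsAll : List (Partial N) → Total N → Bool
avoidsAll σs f = not (any (λ σ → inCube σ f) σs)

avoiders : List (Partial N) → ℕ
avoiders {N} σs = count (avoidsAll σs) (allTotal N)

avoidersWithHead : List (Partial (suc N)) → Bool → ℕ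
avoidersWithHead {N} σs b = count (λ f → avoidsAll σs (b ∷ f)) (allTotal N)

avoiders-suc : (σs : List (Partial (suc N))) (b : Bool) → avoiders σs ≡ avoidersWithHead σs b + avoidersWithHead σs (not b)
avoiders-suc {N} σs true = begin
  count (avoidsAll σs) (map (true ∷_) (allTotal N) ++ map (false ∷_) (allTotal N) ++ [])
    ≡⟨ count-++ (avoidsAll σs) (map (true ∷_) (allTotal N)) _ ⟩
  count (avoidsAll σs) (map (true ∷_) (allTotal N)) + count (avoidsAll σs) (map (false ∷_) (allTotal N) ++ [])
    ≡⟨ cong₂ _+_ (count-map (avoidsAll σs) (true ∷_) (allTotal N))
                 (trans (cong (count (avoidsAll σs)) (++-identityʳ (map (false ∷_) (allTotal N))))
                        (count-map (avoidsAll σs) (false ∷_) (allTotal N))) ⟩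
  avoidersWithHead σs true + avoidersWithHead σs false ∎
  where open ≡-Reasoning
avoiders-suc σs false = trans (avoiders-suc σs true) (+-comm (avoidersWithHead σs true) _)

inCube-tail : (σ : Partial (suc N)) (b : Bool) (f : Total N) → inCube σ (b ∷ f) ≡ true → inCube (tail σ) f ≡ true
inCube-tail (nothing ∷ σ) b f in-σ = in-σ
inCube-tail (just true ∷ σ) b f in-σ = ∧-conicalʳ b _ in-σ
inCube-tail (just false ∷ σ) b f in-σ = ∧-conicalʳ (not b) _ in-σ

avoidsAll-tails : (σs : List (Partial (suc N))) (b : Bool) (f : Total N) →
                  avoidsAll (map tail σs) f ≡ true → avoidsAll σs (b ∷ f) ≡ true
avoidsAll-tails σs b f = not-antitone (λ in-some →
  trans (any-map _ tail σs) (any-mono (λ σ → inCube-tail σ b f) σs in-some))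

inCube-flipped-head : (σ : Partial (suc N)) (b : Bool) (f : Total N) → lookup σ zero ≡ just b → inCube σ (not b ∷ f) ≡ false
inCube-flipped-head (just true ∷ σ) true f refl = refl
inCube-flipped-head (just false ∷ σ) false f refl = refl

avoidsAll-flipped-head : (σs τs : List (Partial (suc N))) (σ : Partial (suc N)) (b : Bool) (f : Total N) → lookup σ zero ≡ just b →
  avoidsAll (map tail (σs ++ τs)) f ≡ true → avoidsAll (σs ++ σ ∷ τs) (not b ∷ f) ≡ true
avoidsAll-flipped-head σs τs σ b f hσ avoids =
  trans (cong not (any-skip _ σs σ τs (inCube-flipped-head σ b f hσ))) (avoidsAll-tails (σs ++ τs) (not b) f avoids)

-- Families of cubes with demands

DCube : ℕ → Set
DCube N = Partial N × ℕ

cubes : List (DCube N) → List (Partial N)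
cubes = map proj₁

totalDemand : List (DCube N) → ℕ
totalDemand [] = 0
totalDemand ((σ , r) ∷ F) = r + totalDemand F

weight : List (DCube N) → ℕ
weight [] = 1
weight ((σ , r) ∷ F) = mersenne r * weight F

HallCondition : List (DCube N) → Set
HallCondition F = ∀ m → totalDemand (select m F) ≤ ⋃domSize (select m (cubes F))

tails : List (DCube (suc N)) → List (DCube N)
tails = map (map₁ tail)

cubes-tails : (F : List (DCube (suc N))) → cubes (tails F) ≡ map tail (cubes F)
cubes-tails F = trans (sym (map-∘ F)) (map-∘ F)

totalDemand-tails : (F : List (DCube (suc N))) → totalDemand (tails F) ≡ totalDemand F
totalDemand-tails [] = refl
totalDemand-tails ((σ , r) ∷ F) = cong (r +_) (totalDemand-tails F)

weight-tails : (F : List (DCube (suc N))) → weight (tails F) ≡ weight F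
weight-tails [] = refl
weight-tails ((σ , r) ∷ F) = cong (mersenne r *_) (weight-tails F)

totalDemand-++ : (F G : List (DCube N)) → totalDemand (F ++ G) ≡ totalDemand F + totalDemand G
totalDemand-++ [] G = refl
totalDemand-++ ((σ , r) ∷ F) G = trans (cong (r +_) (totalDemand-++ F G)) (sym (+-assoc r _ _))

weight-++ : (F G : List (DCube N)) → weight (F ++ G) ≡ weight F * weight G
weight-++ [] G = sym (+-identityʳ _)
weight-++ ((σ , r) ∷ F) G = trans (cong (mersenne r *_) (weight-++ F G)) (sym (*-assoc (mersenne r) _ _))

totalDemand-modular : (m m′ : Mask) (F : List (DCube N)) →
  totalDemand (select (m ∨ᵐ m′) F) + totalDemand (select (m ∧ᵐ m′) F) ≡ totalDemand (select m F) + totalDemand (select m′ F)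
totalDemand-modular m m′ [] = refl
totalDemand-modular [] m′ (c ∷ F) = +-identityʳ _
totalDemand-modular (a ∷ m) [] (c ∷ F) = refl
totalDemand-modular (true ∷ m) (true ∷ m′) ((σ , r) ∷ F) = begin
  (r + A) + (r + B) ≡⟨ +-CS.interchange r A r B ⟩
  (r + r) + (A + B) ≡⟨ cong ((r + r) +_) (totalDemand-modular m m′ F) ⟩
  (r + r) + (C + D) ≡⟨ +-CS.interchange r r C D ⟩
  (r + C) + (r + D) ∎
  where
  open ≡-Reasoning
  A = totalDemand (select (m ∨ᵐ m′) F)
  B = totalDemand (select (m ∧ᵐ m′) F)
  C = totalDemand (select m F)
  D = totalDemand (select m′ F)
totalDemand-modular (true ∷ m) (false ∷ m′) ((σ , r) ∷ F) =
  trans (+-assoc r _ _) (trans (cong (r +_) (totalDemand-modular m m′ F)) (sym (+-assoc r _ _)))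
totalDemand-modular (false ∷ m) (true ∷ m′) ((σ , r) ∷ F) =
  trans (+-assoc r _ _) (trans (cong (r +_) (totalDemand-modular m m′ F)) (+-CS.x∙yz≈y∙xz r (totalDemand (select m F)) _))
totalDemand-modular (false ∷ m) (false ∷ m′) (c ∷ F) = totalDemand-modular m m′ F

totalDemand-select-suc : (m : Mask) (F G : List (DCube N)) (σ : Partial N) (r : ℕ) →
  totalDemand (select m (F ++ (σ , r) ∷ G)) + bit (m selects length F) ≡ totalDemand (select m (F ++ (σ , suc r) ∷ G))
totalDemand-select-suc [] F G σ r =
  trans (+-identityʳ _) (cong totalDemand (trans (select-[]ˡ (F ++ (σ , r) ∷ G)) (sym (select-[]ˡ (F ++ (σ , suc r) ∷ G)))))
totalDemand-select-suc (true ∷ m) [] G σ r = +-comm _ 1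
totalDemand-select-suc (false ∷ m) [] G σ r = +-identityʳ _
totalDemand-select-suc (true ∷ m) ((τ , s) ∷ F) G σ r = trans (+-assoc s _ _) (cong (s +_) (totalDemand-select-suc m F G σ r))
totalDemand-select-suc (false ∷ m) (c ∷ F) G σ r = totalDemand-select-suc m F G σ r

cubes-demand-irrelevant : (F G : List (DCube N)) (σ : Partial N) (r r′ : ℕ) → cubes (F ++ (σ , r) ∷ G) ≡ cubes (F ++ (σ , r′) ∷ G)
cubes-demand-irrelevant F G σ r r′ = trans (map-++ proj₁ F _) (sym (map-++ proj₁ F _))

weight-middle : (F G : List (DCube N)) (σ : Partial N) (r : ℕ) → weight (F ++ (σ , r) ∷ G) ≡ mersenne r * (weight F * weight G)
weight-middle F G σ r = trans (weight-++ F _) (*-CS.x∙yz≈y∙xz (weight F) (mersenne r) (weight G))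

totalDemand-middle : (F G : List (DCube N)) (σ : Partial N) (r : ℕ) → totalDemand (F ++ (σ , r) ∷ G) ≡ r + (totalDemand F + totalDemand G)
totalDemand-middle F G σ r = trans (totalDemand-++ F _) (+-CS.x∙yz≈y∙xz (totalDemand F) r (totalDemand G))

-- Deficient subfamilies and the avoidance bound

<ᵇ-true⇒< : ∀ m n → (m <ᵇ n) ≡ true → m < n
<ᵇ-true⇒< m n eq = <ᵇ⇒< m n (Equivalence.from T-≡ eq)

<⇒<ᵇ-true : ∀ {m n} → m < n → (m <ᵇ n) ≡ true
<⇒<ᵇ-true m<n = Equivalence.to T-≡ (<⇒<ᵇ m<n)

<ᵇ-false⇒≥ : ∀ m n → (m <ᵇ n) ≡ false → n ≤ m
<ᵇ-false⇒≥ m n eq = ≮⇒≥ (λ m<n → contradiction (trans (sym (<⇒<ᵇ-true m<n)) eq) λ ())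

-- Demand is modular and coverage submodular, and by the Hall condition a union is deficient by at
-- most one; so the meet of two deficient subfamilies is deficient.
deficiency-meet : ∀ {dᵤ dᵢ d₁ d₂ cᵤ cᵢ c₁ c₂} → dᵤ + dᵢ ≡ d₁ + d₂ → dᵤ ≤ suc cᵤ → cᵤ + cᵢ ≤ c₁ + c₂ →
                  c₁ < d₁ → c₂ < d₂ → cᵢ < dᵢ
deficiency-meet {dᵤ} {dᵢ} {d₁} {d₂} {cᵤ} {cᵢ} {c₁} {c₂} modular union-tight submodular def₁ def₂ =
  +-cancelˡ-≤ dᵤ (suc cᵢ) dᵢ (begin
    dᵤ + suc cᵢ           ≤⟨ +-monoˡ-≤ (suc cᵢ) union-tight ⟩
    suc cᵤ + suc cᵢ       ≡⟨ cong suc (+-suc cᵤ cᵢ) ⟩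
    suc (suc (cᵤ + cᵢ))   ≤⟨ s≤s (s≤s submodular) ⟩
    suc (suc (c₁ + c₂))   ≡⟨ cong suc (+-suc c₁ c₂) ⟨
    suc c₁ + suc c₂       ≤⟨ +-mono-≤ def₁ def₂ ⟩
    d₁ + d₂               ≡⟨ modular ⟨
    dᵤ + dᵢ               ∎)
  where open ≤-Reasoning

module Deficiency {N : ℕ} (F : List (DCube (suc N))) where

  demandOf : Mask → ℕ
  demandOf m = totalDemand (select m F)

  tailCoverage : Mask → ℕ
  tailCoverage m = ⋃domSize (select m (cubes (tails F)))

  deficient : Mask → Bool
  deficient m = tailCoverage m <ᵇ demandOf m

  deficient⇒< : ∀ m → deficient m ≡ true → tailCoverage m < demandOf m
  deficient⇒< m = <ᵇ-true⇒< (tailCoverage m) (demandOf m)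

  <⇒deficient : ∀ m → tailCoverage m < demandOf m → deficient m ≡ true
  <⇒deficient m = <⇒<ᵇ-true

  ¬deficient⇒≤ : ∀ m → deficient m ≡ false → demandOf m ≤ tailCoverage m
  ¬deficient⇒≤ m = <ᵇ-false⇒≥ (tailCoverage m) (demandOf m)

  size : Mask → ℕ
  size m = length (select m F)

  ⋃domSize-select : ∀ m → ⋃domSize (select m (cubes F)) ≡ bit (usesHead (select m (cubes F))) + tailCoverage m
  ⋃domSize-select m = trans (⋃domSize-suc (select m (cubes F)))
    (cong (λ σs → bit (usesHead (select m (cubes F))) + ⋃domSize σs)
          (trans (sym (select-map tail m (cubes F))) (cong (select m) (sym (cubes-tails F)))))

  demandOf-tails : ∀ m → totalDemand (select m (tails F)) ≡ demandOf m
  demandOf-tails m = trans (cong totalDemand (select-map (map₁ tail) m F)) (totalDemand-tails (select m F))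

  deficient-resize : ∀ m → deficient (resize (length F) m) ≡ deficient m
  deficient-resize m = cong₂ _<ᵇ_
    (cong ⋃domSize (trans (cong (λ n → select (resize n m) (cubes (tails F))) (sym (trans (length-map _ (tails F)) (length-map _ F))))
                            (select-resize m (cubes (tails F)))))
    (cong totalDemand (select-resize m F))

  size-resize : ∀ m → size (resize (length F) m) ≡ size m
  size-resize m = cong length (select-resize m F)

  hall-tails : (∀ m → deficient (resize (length F) m) ≡ false) → HallCondition (tails F)
  hall-tails none m = subst (_≤ tailCoverage m) (sym (demandOf-tails m)) (¬deficient⇒≤ m (trans (sym (deficient-resize m)) (none m)))

  avoiders-tails : ∀ b → avoiders (cubes (tails F)) ≤ avoidersWithHead (cubes F) b
  avoiders-tails b = count-mono (λ f avoids → avoidsAll-tails (cubes F) b f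
    (subst (λ σs → avoidsAll σs f ≡ true) (cubes-tails F) avoids)) (allTotal N)

  module _ (hall : HallCondition F) where

    demand≤1+tailCoverage : ∀ m → demandOf m ≤ suc (tailCoverage m)
    demand≤1+tailCoverage m = ≤-trans (hall m) (≤-trans (≤-reflexive (⋃domSize-select m)) (+-monoˡ-≤ _ (bit≤1 _)))

    deficient⇒usesHead : ∀ m → deficient m ≡ true → usesHead (select m (cubes F)) ≡ true
    deficient⇒usesHead m def with usesHead (select m (cubes F)) in uses
    ... | true = refl
    ... | false = ⊥-elim (<⇒≱ (deficient⇒< m def)
      (≤-trans (hall m) (≤-reflexive (trans (⋃domSize-select m) (cong (λ b → bit b + tailCoverage m) uses)))))

    deficient-∧ᵐ : ∀ m m′ → deficient m ≡ true → deficient m′ ≡ true → deficient (m ∧ᵐ m′) ≡ true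
    deficient-∧ᵐ m m′ def def′ = <⇒deficient (m ∧ᵐ m′)
      (deficiency-meet (totalDemand-modular m m′ F) (demand≤1+tailCoverage (m ∨ᵐ m′))
                       (⋃domSize-submodular m m′ (cubes (tails F))) (deficient⇒< m def) (deficient⇒< m′ def′))

    minimal-deficient : ∀ n m → deficient m ≡ true → size m ≤ n →
      Σ Mask λ m* → deficient m* ≡ true × (∀ m′ → deficient m′ ≡ true → size m* ≤ size m′)
    minimal-deficient zero m def size≤0 = m , def , λ _ _ → ≤-trans size≤0 z≤n
    minimal-deficient (suc n) m def size≤ with search-masks (length F) (λ m′ → deficient m′ ∧ (size m′ <ᵇ size m))
    ... | inj₁ (m′ , smaller) = minimal-deficient n m′ (∧-conicalˡ _ _ smaller)
                                  (≤-pred (≤-trans (<ᵇ-true⇒< _ _ (∧-conicalʳ _ _ smaller)) size≤))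
    ... | inj₂ none-smaller = m , def , λ m′ def′ → <ᵇ-false⇒≥ (size m′) (size m)
      (trans (sym (cong₂ (λ d s → d ∧ (s <ᵇ size m)) (trans (deficient-resize m′) def′) (size-resize m′))) (none-smaller m′))

    -- A deficient mask of minimal size lies inside every deficient mask, since their meet is
    -- deficient; and by the Hall condition one of its cubes fixes coordinate 0.
    common-head-cube : ∀ m → deficient m ≡ true →
      Σ (List (DCube (suc N))) λ Fl → Σ (DCube (suc N)) λ c → Σ (List (DCube (suc N))) λ Fr →
        F ≡ Fl ++ c ∷ Fr × is-just (lookup (proj₁ c) zero) ≡ true ×
        (∀ m′ → deficient m′ ≡ true → m′ selects length Fl ≡ true)
    common-head-cube m def with minimal-deficient (size m) m def ≤-refl
    ... | m* , def* , minimal with split-at-selected (λ c → is-just (lookup (proj₁ c) zero)) m* F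
      (trans (sym (any-map _ proj₁ (select m* F))) (trans (cong usesHead (sym (select-map proj₁ m* F))) (deficient⇒usesHead m* def*)))
    ... | Fl , c , Fr , F≡ , selected , uses = Fl , c , Fr , F≡ , uses , λ m′ def′ →
      length-select-∧ᵐ-≡⇒selects m* m′ Fl c Fr
        (subst (λ xs → length (select (m* ∧ᵐ m′) xs) ≡ length (select m* xs)) F≡
          (≤-antisym (length-select-∧ᵐ m* m′ F) (minimal (m* ∧ᵐ m′) (deficient-∧ᵐ m* m′ def* def′))))
        selected

split-arithmetic : ∀ P W a h₁ h₂ w → P * W ≤ a * w → a ≤ h₁ → a ≤ h₂ → 2 * P * W ≤ (h₁ + h₂) * w
split-arithmetic P W a h₁ h₂ w PW≤aw a≤h₁ a≤h₂ = begin
  2 * P * W               ≡⟨ double P W ⟩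
  P * W + P * W           ≤⟨ +-mono-≤ PW≤aw PW≤aw ⟩
  a * w + a * w           ≤⟨ +-mono-≤ (*-monoˡ-≤ w a≤h₁) (*-monoˡ-≤ w a≤h₂) ⟩
  h₁ * w + h₂ * w         ≡⟨ *-distribʳ-+ w h₁ h₂ ⟨
  (h₁ + h₂) * w           ∎
  where
  open ≤-Reasoning
  double : ∀ P W → 2 * P * W ≡ P * W + P * W
  double = solve-∀

head-split-arithmetic : ∀ P X D a h w → P * (D * X) ≤ a * (suc D * w) → P * X ≤ h * w →
                        2 * P * (suc (2 * D) * X) ≤ (a + h) * (2 * (suc D * w))
head-split-arithmetic P X D a h w lowered removed = begin
  2 * P * (suc (2 * D) * X)                      ≡⟨ expand P X D ⟩
  2 * (P * (D * X)) + 2 * (suc D * (P * X))      ≤⟨ +-mono-≤ (*-monoʳ-≤ 2 lowered) (*-monoʳ-≤ 2 (*-monoʳ-≤ (suc D) removed)) ⟩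
  2 * (a * (suc D * w)) + 2 * (suc D * (h * w))  ≡⟨ collect a h D w ⟩
  (a + h) * (2 * (suc D * w))                    ∎
  where
  open ≤-Reasoning
  expand : ∀ P X D → 2 * P * (suc (2 * D) * X) ≡ 2 * (P * (D * X)) + 2 * (suc D * (P * X))
  expand = solve-∀
  collect : ∀ a h D w → 2 * (a * (suc D * w)) + 2 * (suc D * (h * w)) ≡ (a + h) * (2 * (suc D * w))
  collect = solve-∀

module HeadCubeStep {N : ℕ}
  (IH : (G : List (DCube N)) → HallCondition G → 2 ^ N * weight G ≤ avoiders (cubes G) * 2 ^ totalDemand G)
  (Fl Fr : List (DCube (suc N))) (σ : Partial (suc N)) (r : ℕ) (b : Bool) (σ₀≡b : lookup σ zero ≡ just b) where

  F lowered removed : List (DCube _)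
  F = Fl ++ (σ , suc r) ∷ Fr
  lowered = tails Fl ++ (tail σ , r) ∷ tails Fr
  removed = tails Fl ++ tails Fr

  open Deficiency F

  tails-F : tails F ≡ tails Fl ++ (tail σ , suc r) ∷ tails Fr
  tails-F = map-++ (map₁ tail) Fl _

  cubes-lowered : cubes lowered ≡ cubes (tails F)
  cubes-lowered = trans (cubes-demand-irrelevant (tails Fl) (tails Fr) (tail σ) r (suc r)) (cong cubes (sym tails-F))

  demand-lowered : ∀ m → totalDemand (select m lowered) + bit (m selects length Fl) ≡ demandOf m
  demand-lowered m = begin
    totalDemand (select m lowered) + bit (m selects length Fl)
      ≡⟨ cong (λ n → totalDemand (select m lowered) + bit (m selects n)) (length-map (map₁ tail) Fl) ⟨
    totalDemand (select m lowered) + bit (m selects length (tails Fl))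
      ≡⟨ totalDemand-select-suc m (tails Fl) (tails Fr) (tail σ) r ⟩
    totalDemand (select m (tails Fl ++ (tail σ , suc r) ∷ tails Fr))
      ≡⟨ cong (totalDemand ∘ select m) tails-F ⟨
    totalDemand (select m (tails F))
      ≡⟨ demandOf-tails m ⟩
    demandOf m ∎
    where open ≡-Reasoning

  module _ (hall : HallCondition F) (always-selected : ∀ m → deficient m ≡ true → m selects length Fl ≡ true) where

    demand-bound : ∀ m → demandOf m ≤ bit (m selects length Fl) + tailCoverage m
    demand-bound m with deficient m in def
    ... | true rewrite always-selected m def = demand≤1+tailCoverage hall m
    ... | false = ≤-trans (¬deficient⇒≤ m def) (m≤n+m _ _)

    hall-lowered : HallCondition lowered
    hall-lowered m = +-cancelˡ-≤ (bit (m selects length Fl)) _ _ (begin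
      bit (m selects length Fl) + totalDemand (select m lowered) ≡⟨ +-comm (bit (m selects length Fl)) _ ⟩
      totalDemand (select m lowered) + bit (m selects length Fl) ≡⟨ demand-lowered m ⟩
      demandOf m                                                 ≤⟨ demand-bound m ⟩
      bit (m selects length Fl) + tailCoverage m                 ≡⟨ cong (λ σs → _ + ⋃domSize (select m σs)) cubes-lowered ⟨
      bit (m selects length Fl) + ⋃domSize (select m (cubes lowered)) ∎)
      where open ≤-Reasoning

    hall-removed : HallCondition removed
    hall-removed m = subst₂ _≤_ (cong totalDemand skip)
      (cong ⋃domSize (trans (select-map proj₁ m′ lowered) (trans (cong cubes skip) (sym (select-map proj₁ m removed)))))
      (hall-lowered m′)
      where
      m′ = skipAt (length (tails Fl)) m
      skip : select m′ lowered ≡ select m removed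
      skip = select-skipAt m (tails Fl) (tail σ , r) (tails Fr)

    avoiders-lowered : avoiders (cubes lowered) ≤ avoidersWithHead (cubes F) b
    avoiders-lowered = count-mono (λ f avoids → avoidsAll-tails (cubes F) b f
      (subst (λ σs → avoidsAll σs f ≡ true) (trans cubes-lowered (cubes-tails F)) avoids)) (allTotal N)

    avoiders-removed : avoiders (cubes removed) ≤ avoidersWithHead (cubes F) (not b)
    avoiders-removed = count-mono (λ f avoids → subst (λ σs → avoidsAll σs (not b ∷ f) ≡ true) (sym (map-++ proj₁ Fl _))
      (avoidsAll-flipped-head (cubes Fl) (cubes Fr) σ b f σ₀≡b
        (subst (λ σs → avoidsAll σs f ≡ true) cubes-removed avoids))) (allTotal N)
      where
      cubes-removed : cubes removed ≡ map tail (cubes Fl ++ cubes Fr)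
      cubes-removed = trans (cong cubes (sym (map-++ (map₁ tail) Fl Fr))) (trans (cubes-tails (Fl ++ Fr)) (cong (map tail) (map-++ proj₁ Fl Fr)))

    restWeight = weight Fl * weight Fr
    restDemand = totalDemand Fl + totalDemand Fr

    weights-tails : weight (tails Fl) * weight (tails Fr) ≡ restWeight
    weights-tails = cong₂ _*_ (weight-tails Fl) (weight-tails Fr)

    demands-tails : totalDemand (tails Fl) + totalDemand (tails Fr) ≡ restDemand
    demands-tails = cong₂ _+_ (totalDemand-tails Fl) (totalDemand-tails Fr)

    weight-removed : weight removed ≡ restWeight
    weight-removed = trans (weight-++ (tails Fl) (tails Fr)) weights-tails

    totalDemand-removed : totalDemand removed ≡ restDemand
    totalDemand-removed = trans (totalDemand-++ (tails Fl) (tails Fr)) demands-tails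

    lowered-bound : 2 ^ N * (mersenne r * restWeight) ≤ avoidersWithHead (cubes F) b * (suc (mersenne r) * 2 ^ restDemand)
    lowered-bound = begin
      2 ^ N * (mersenne r * restWeight)                               ≡⟨ cong (λ x → 2 ^ N * (mersenne r * x)) weights-tails ⟨
      2 ^ N * (mersenne r * (weight (tails Fl) * weight (tails Fr))) ≡⟨ cong (2 ^ N *_) (weight-middle (tails Fl) (tails Fr) (tail σ) r) ⟨
      2 ^ N * weight lowered                                 ≤⟨ IH lowered hall-lowered ⟩
      avoiders (cubes lowered) * 2 ^ totalDemand lowered     ≡⟨ cong (λ e → avoiders (cubes lowered) * 2 ^ e) demand ⟩
      avoiders (cubes lowered) * 2 ^ (r + restDemand)                 ≡⟨ cong (avoiders (cubes lowered) *_) power ⟩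
      avoiders (cubes lowered) * (suc (mersenne r) * 2 ^ restDemand)  ≤⟨ *-monoˡ-≤ _ avoiders-lowered ⟩
      avoidersWithHead (cubes F) b * (suc (mersenne r) * 2 ^ restDemand) ∎
      where
      open ≤-Reasoning
      demand : totalDemand lowered ≡ r + restDemand
      demand = trans (totalDemand-middle (tails Fl) (tails Fr) (tail σ) r) (cong (r +_) demands-tails)
      power : 2 ^ (r + restDemand) ≡ suc (mersenne r) * 2 ^ restDemand
      power = trans (^-distribˡ-+-* 2 r restDemand) (cong (_* 2 ^ restDemand) (sym (suc-mersenne r)))

    removed-bound : 2 ^ N * restWeight ≤ avoidersWithHead (cubes F) (not b) * 2 ^ restDemand
    removed-bound = begin
      2 ^ N * restWeight                                   ≡⟨ cong (2 ^ N *_) weight-removed ⟨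
      2 ^ N * weight removed                      ≤⟨ IH removed hall-removed ⟩
      avoiders (cubes removed) * 2 ^ totalDemand removed ≡⟨ cong (λ e → avoiders (cubes removed) * 2 ^ e) totalDemand-removed ⟩
      avoiders (cubes removed) * 2 ^ restDemand            ≤⟨ *-monoˡ-≤ _ avoiders-removed ⟩
      avoidersWithHead (cubes F) (not b) * 2 ^ restDemand  ∎
      where open ≤-Reasoning

    avoiders-bound-step : 2 ^ suc N * weight F ≤ avoiders (cubes F) * 2 ^ totalDemand F
    avoiders-bound-step = begin
      2 ^ suc N * weight F
        ≡⟨ cong (2 ^ suc N *_) (weight-middle Fl Fr σ (suc r)) ⟩
      2 * 2 ^ N * (suc (2 * mersenne r) * restWeight)
        ≤⟨ head-split-arithmetic (2 ^ N) restWeight (mersenne r) (avoidersWithHead (cubes F) b) _ (2 ^ restDemand)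
                                 lowered-bound removed-bound ⟩
      (avoidersWithHead (cubes F) b + avoidersWithHead (cubes F) (not b)) * (2 * (suc (mersenne r) * 2 ^ restDemand))
        ≡⟨ cong₂ _*_ (avoiders-suc (cubes F) b) (cong (λ x → 2 * (x * 2 ^ restDemand)) (sym (suc-mersenne r))) ⟨
      avoiders (cubes F) * (2 * (2 ^ r * 2 ^ restDemand))
        ≡⟨ cong (λ e → avoiders (cubes F) * (2 * e)) (^-distribˡ-+-* 2 r restDemand) ⟨
      avoiders (cubes F) * 2 ^ (suc r + restDemand)
        ≡⟨ cong (λ e → avoiders (cubes F) * 2 ^ e) (totalDemand-middle Fl Fr σ (suc r)) ⟨
      avoiders (cubes F) * 2 ^ totalDemand F ∎
      where open ≤-Reasoning

-- |avoiders| ≥ 2^N ∏ (1 − 2^−r), with the denominators cleared.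
avoiders-bound : ∀ N (F : List (DCube N)) → HallCondition F → 2 ^ N * weight F ≤ avoiders (cubes F) * 2 ^ totalDemand F
avoiders-bound zero [] hall = ≤-refl
avoiders-bound zero ((σ , zero) ∷ F) hall = z≤n
avoiders-bound zero ((σ , suc r) ∷ F) hall with () ← hall (true ∷ [])
avoiders-bound (suc N) F hall with search-masks (length F) (Deficiency.deficient F)
... | inj₂ none = begin
  2 * 2 ^ N * weight F
    ≤⟨ split-arithmetic (2 ^ N) (weight F) (avoiders (cubes (tails F))) _ _ (2 ^ totalDemand F)
                        tails-bound (avoiders-tails true) (avoiders-tails false) ⟩
  (avoidersWithHead (cubes F) true + avoidersWithHead (cubes F) false) * 2 ^ totalDemand F
    ≡⟨ cong (_* 2 ^ totalDemand F) (avoiders-suc (cubes F) true) ⟨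
  avoiders (cubes F) * 2 ^ totalDemand F ∎
  where
  open Deficiency F
  open ≤-Reasoning
  tails-bound : 2 ^ N * weight F ≤ avoiders (cubes (tails F)) * 2 ^ totalDemand F
  tails-bound = subst₂ (λ w d → 2 ^ N * w ≤ avoiders (cubes (tails F)) * 2 ^ d) (weight-tails F) (totalDemand-tails F)
                       (avoiders-bound N (tails F) (hall-tails none))
... | inj₁ (m , def) with Deficiency.common-head-cube F hall m def
... | Fl , (σ , zero) , Fr , refl , _ , _ =
  ≤-trans (≤-reflexive (trans (cong (2 ^ suc N *_) (weight-middle Fl Fr σ 0)) (*-zeroʳ (2 ^ suc N)))) z≤n
... | Fl , (σ , suc r) , Fr , refl , uses , always-selected with lookup σ zero in σ₀
... | just b = HeadCubeStep.avoiders-bound-step (avoiders-bound N) Fl Fr σ r b σ₀ hall always-selected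
... | nothing with () ← uses

-- Minimal cubes disjoint from A

∈-allVecs : (xs : List X) → (∀ x → x ∈ xs) → ∀ {n} (v : Vec X n) → v ∈ allVecs xs n
∈-allVecs xs complete [] = here refl
∈-allVecs xs complete (x ∷ v) =
  ∈-concatMap⁺ _ (Any.map (λ { refl → ∈-map⁺ (x ∷_) (∈-allVecs xs complete v) }) (complete x))

∈-allTotal : (f : Total N) → f ∈ allTotal N
∈-allTotal = ∈-allVecs _ λ where
  true → here refl
  false → there (here refl)

∈-allPartial : (σ : Partial N) → σ ∈ allPartial N
∈-allPartial = ∈-allVecs _ λ where
  nothing → here refl
  (just true) → there (here refl)
  (just false) → there (there (here refl))

⊑⇒inCube : (σ : Partial N) (f : Total N) → σ ⊑ f → inCube σ f ≡ true
⊑⇒inCube [] [] _ = refl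
⊑⇒inCube (nothing ∷ σ) (b ∷ f) σ⊑ = ⊑⇒inCube σ f (λ i → σ⊑ (suc i))
⊑⇒inCube (just c ∷ σ) (b ∷ f) σ⊑ with σ⊑ zero c refl
⊑⇒inCube (just true ∷ σ) (true ∷ f) σ⊑ | refl = ⊑⇒inCube σ f (λ i → σ⊑ (suc i))
⊑⇒inCube (just false ∷ σ) (false ∷ f) σ⊑ | refl = ⊑⇒inCube σ f (λ i → σ⊑ (suc i))

inCube⇒⊑ : (σ : Partial N) (f : Total N) → inCube σ f ≡ true → σ ⊑ f
inCube⇒⊑ (just true ∷ σ) (true ∷ f) _ zero b refl = refl
inCube⇒⊑ (just false ∷ σ) (false ∷ f) _ zero b refl = refl
inCube⇒⊑ (nothing ∷ σ) (b ∷ f) in-σ (suc i) = inCube⇒⊑ σ f in-σ i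
inCube⇒⊑ (just true ∷ σ) (b ∷ f) in-σ (suc i) = inCube⇒⊑ σ f (∧-conicalʳ b _ in-σ) i
inCube⇒⊑ (just false ∷ σ) (b ∷ f) in-σ (suc i) = inCube⇒⊑ σ f (∧-conicalʳ (not b) _ in-σ) i

⊆p-⊑ : {ρ σ : Partial N} {f : Total N} → ρ ⊆p σ → σ ⊑ f → ρ ⊑ f
⊆p-⊑ ρ⊆σ σ⊑f i b ρi = σ⊑f i b (ρ⊆σ i b ρi)

clear : Partial N → Fin N → Partial N
clear (v ∷ σ) zero = nothing ∷ σ
clear (v ∷ σ) (suc i) = v ∷ clear σ i

clear-⊆p : (σ : Partial N) (i : Fin N) → clear σ i ⊆p σ
clear-⊆p (v ∷ σ) zero (suc j) b eq = eq
clear-⊆p (v ∷ σ) (suc i) zero b eq = eq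
clear-⊆p (v ∷ σ) (suc i) (suc j) b eq = clear-⊆p σ i j b eq

⊆p-clear : (ρ σ : Partial N) (i : Fin N) → ρ ⊆p σ → lookup ρ i ≡ nothing → ρ ⊆p clear σ i
⊆p-clear (u ∷ ρ) (v ∷ σ) zero ρ⊆σ ρi zero b eq with () ← trans (sym ρi) eq
⊆p-clear (u ∷ ρ) (v ∷ σ) zero ρ⊆σ ρi (suc j) b eq = ρ⊆σ (suc j) b eq
⊆p-clear (u ∷ ρ) (v ∷ σ) (suc i) ρ⊆σ ρi zero b eq = ρ⊆σ zero b eq
⊆p-clear (u ∷ ρ) (v ∷ σ) (suc i) ρ⊆σ ρi (suc j) b eq = ⊆p-clear ρ σ i (λ j → ρ⊆σ (suc j)) ρi j b eq

domSize : Partial N → ℕ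
domSize [] = 0
domSize (v ∷ σ) = bit (is-just v) + domSize σ

domSize≤ : (σ : Partial N) → domSize σ ≤ N
domSize≤ [] = z≤n
domSize≤ (v ∷ σ) = +-mono-≤ (bit≤1 (is-just v)) (domSize≤ σ)

domSize-clear : (σ : Partial N) (i : Fin N) → is-just (lookup σ i) ≡ true → domSize (clear σ i) < domSize σ
domSize-clear (just b ∷ σ) zero _ = ≤-refl
domSize-clear (v ∷ σ) (suc i) σi =
  ≤-trans (≤-reflexive (sym (+-suc (bit (is-just v)) _))) (+-monoʳ-≤ (bit (is-just v)) (domSize-clear σ i σi))

⊊p⇒dropped : (ρ σ : Partial N) → ρ ⊊p σ → Σ (Fin N) λ i → lookup ρ i ≡ nothing × is-just (lookup σ i) ≡ true
⊊p⇒dropped [] [] (_ , ρ≢σ) = ⊥-elim (ρ≢σ refl)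
⊊p⇒dropped (nothing ∷ ρ) (just c ∷ σ) _ = zero , refl , refl
⊊p⇒dropped (nothing ∷ ρ) (nothing ∷ σ) (ρ⊆σ , ρ≢σ)
  with i , ρi , σi ← ⊊p⇒dropped ρ σ ((λ j → ρ⊆σ (suc j)) , (λ eq → ρ≢σ (cong (nothing ∷_) eq))) = suc i , ρi , σi
⊊p⇒dropped (just b ∷ ρ) (v ∷ σ) (ρ⊆σ , ρ≢σ) with refl ← ρ⊆σ zero b refl
  with i , ρi , σi ← ⊊p⇒dropped ρ σ ((λ j → ρ⊆σ (suc j)) , (λ eq → ρ≢σ (cong (just b ∷_) eq))) = suc i , ρi , σi

point : Total N → Partial N
point = Vec.map just

point⊑⇒≡ : (f g : Total N) → point f ⊑ g → g ≡ f
point⊑⇒≡ [] [] _ = refl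
point⊑⇒≡ (b ∷ f) (c ∷ g) f⊑g = cong₂ _∷_ (f⊑g zero b refl) (point⊑⇒≡ f g (λ i → f⊑g (suc i)))

module MinimalCubes (A : TSet N) where

  Disjoint : Partial N → Set
  Disjoint σ = ∀ f → σ ⊑ f → A f ≡ false

  meets : Partial N → Bool
  meets σ = any (λ f → inCube σ f ∧ A f) (allTotal N)

  meets⇒witness : ∀ σ → meets σ ≡ true → Σ (Total N) λ f → σ ⊑ f × A f ≡ true
  meets⇒witness σ meets≡true with f , _ , in∧A ← any⇒∈ _ (allTotal N) meets≡true =
    f , inCube⇒⊑ σ f (∧-conicalˡ _ _ in∧A) , ∧-conicalʳ (inCube σ f) _ in∧A

  ¬meets⇒Disjoint : ∀ σ → meets σ ≡ false → Disjoint σ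
  ¬meets⇒Disjoint σ ¬meets f σ⊑f with A f in Af
  ... | false = refl
  ... | true = contradiction (trans (sym (∈⇒any _ (∈-allTotal f) (cong₂ _∧_ (⊑⇒inCube σ f σ⊑f) Af))) ¬meets) λ ()

  removable : Partial N → Fin N → Bool
  removable σ i = is-just (lookup σ i) ∧ not (meets (clear σ i))

  minimal-below : ∀ n σ → domSize σ ≤ n → Disjoint σ → Σ (Partial N) λ τ → τ ∈Δ A × τ ⊆p σ
  minimal-below n σ size≤ disjoint with any (removable σ) (allFin N) in some-removable
  ... | false = σ , (disjoint , proper-subcubes-meet) , λ _ _ eq → eq
    where
    proper-subcubes-meet : ∀ ρ → ρ ⊊p σ → Σ (Total N) λ f → ρ ⊑ f × A f ≡ true
    proper-subcubes-meet ρ ρ⊊σ with i , ρi , σi ← ⊊p⇒dropped ρ σ ρ⊊σ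
      with meets (clear σ i) in meets-clear | any-false⇒false (removable σ) some-removable (∈-allFin i)
    ... | true | _ with f , clear⊑f , Af ← meets⇒witness (clear σ i) meets-clear =
      f , ⊆p-⊑ {ρ = ρ} {clear σ i} {f} (⊆p-clear ρ σ i (proj₁ ρ⊊σ) ρi) clear⊑f , Af
    ... | false | not-removable rewrite σi with () ← not-removable
  ... | true with i , _ , rem ← any⇒∈ (removable σ) (allFin N) some-removable =
    shrink n size≤ (∧-conicalˡ _ _ rem) (not-injective {meets (clear σ i)} {false} (∧-conicalʳ (is-just (lookup σ i)) _ rem))
    where
    shrink : ∀ n → domSize σ ≤ n → is-just (lookup σ i) ≡ true → meets (clear σ i) ≡ false →
             Σ (Partial N) λ τ → τ ∈Δ A × τ ⊆p σ
    shrink zero size≤0 σi _ = ⊥-elim (n≮0 (≤-trans (domSize-clear σ i σi) size≤0))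
    shrink (suc n) size≤ σi ¬meets
      with τ , τ∈Δ , τ⊆ ← minimal-below n (clear σ i) (≤-pred (≤-trans (domSize-clear σ i σi) size≤))
                                        (¬meets⇒Disjoint (clear σ i) ¬meets)
      = τ , τ∈Δ , λ j b eq → clear-⊆p σ i j b (τ⊆ j b eq)

  -- Shrinking the one-point cube of f to a minimal cube disjoint from A yields an element of Δ(A).
  outside-covered : (δ : PSet N) → (λ σ → σ ∈Δ A) ⪯ δ → ∀ f → A f ≡ false →
                    Σ (Partial N) λ ρ → δ ρ ≡ true × ρ ⊑ f
  outside-covered δ Δ⪯δ f Af
    with τ , τ∈Δ , τ⊆f ← minimal-below N (point f) (domSize≤ (point f)) (λ g f⊑g → trans (cong A (point⊑⇒≡ f g f⊑g)) Af)
    with ρ , δρ , ρ⊆τ ← Δ⪯δ τ τ∈Δ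
    = ρ , δρ , λ i b eq → just-injective (trans (sym (lookup-map i just f)) (τ⊆f i b (ρ⊆τ i b eq)))

-- The family of cubes given by hn

_≟ₚ_ : (σ τ : Partial N) → Dec (σ ≡ τ)
_≟ₚ_ = Vecₚ.≡-dec (Maybeₚ.≡-dec Boolₚ._≟_)

does-true⇒ : {P : Set} (p? : Dec P) → does p? ≡ true → P
does-true⇒ (yes p) _ = p

⇒does-true : {P : Set} (p? : Dec P) → P → does p? ≡ true
⇒does-true (yes _) _ = refl
⇒does-true (no ¬p) p with () ← ¬p p

constantDemand : ℕ → List (Partial N) → List (DCube N)
constantDemand k = map (_, k)

cubes-constantDemand : (k : ℕ) (σs : List (Partial N)) → cubes (constantDemand k σs) ≡ σs
cubes-constantDemand k σs = trans (sym (map-∘ σs)) (map-id σs)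

totalDemand-constantDemand : (k : ℕ) (σs : List (Partial N)) → totalDemand (constantDemand k σs) ≡ k * length σs
totalDemand-constantDemand k [] = sym (*-zeroʳ k)
totalDemand-constantDemand k (σ ∷ σs) = trans (cong (k +_) (totalDemand-constantDemand k σs)) (sym (*-suc k (length σs)))

weight-constantDemand : (k : ℕ) (σs : List (Partial N)) → weight (constantDemand k σs) ≡ mersenne k ^ length σs
weight-constantDemand k [] = refl
weight-constantDemand k (σ ∷ σs) = cong (mersenne k *_) (weight-constantDemand k σs)

module HnFamily {N : ℕ} (δ : PSet N) (k : ℕ) (hn : HnCond δ k) where

  open DecMembership (_≟ₚ_ {N}) using (_∈?_)

  members : List (Partial N)
  members = filterᵇ δ (allPartial N)

  family : List (DCube N)
  family = constantDemand k members

  members⊆ : members ⊆ allPartial N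
  members⊆ = filter-⊆ (T? ∘ δ) (allPartial N)

  member⇒δ : ∀ {σ} → σ ∈ members → δ σ ≡ true
  member⇒δ {σ} σ∈ = Equivalence.to T-≡ (proj₂ (∈-filter⁻ (T? ∘ δ) {v = σ} {xs = allPartial N} σ∈))

  chosen : Mask → List (Partial N)
  chosen m = select m members

  δ-chosen : Mask → PSet N
  δ-chosen m σ = δ σ ∧ does (σ ∈? chosen m)

  chosen⇒δ-chosen : ∀ m σ → σ ∈ chosen m → δ-chosen m σ ≡ true
  chosen⇒δ-chosen m σ σ∈ = cong₂ _∧_ (member⇒δ (Any-resp-⊆ (select-⊆ m members) σ∈)) (⇒does-true (σ ∈? chosen m) σ∈)

  ⋃dom≤⋃domSize : ∀ m δ″ → δ″ ⊆S δ-chosen m → ∣⋃dom∣ δ″ ≤ ⋃domSize (chosen m)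
  ⋃dom≤⋃domSize m δ″ δ″⊆ = count-mono covered (allFin N)
    where
    covered : ∀ i → any (λ σ → δ″ σ ∧ is-just (lookup σ i)) (allPartial N) ≡ true →
              any (λ σ → is-just (lookup σ i)) (chosen m) ≡ true
    covered i covered-by-δ″ with σ , _ , δ″σ∧i ← any⇒∈ _ (allPartial N) covered-by-δ″ =
      ∈⇒any _ (does-true⇒ (σ ∈? chosen m) (∧-conicalʳ (δ σ) _ (δ″⊆ σ (∧-conicalˡ _ _ δ″σ∧i))))
              (∧-conicalʳ (δ″ σ) _ δ″σ∧i)

  -- The cubes chosen by m form δ′ ⊆ δ, and hn(δ) > k bounds their demand k |δ′| by |⋃ dom δ″|
  -- for some δ″ ⊆ δ′.
  hall : HallCondition family
  hall m with δ″ , δ″⊆ , _ , k∣δ′∣≤ ← hn (δ-chosen m) (λ σ → ∧-conicalˡ (δ σ) _) = begin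
    totalDemand (select m family)                 ≡⟨ cong totalDemand (select-map (_, k) m members) ⟩
    totalDemand (constantDemand k (chosen m))     ≡⟨ totalDemand-constantDemand k (chosen m) ⟩
    k * length (chosen m)                         ≤⟨ *-monoʳ-≤ k (length≤count (⊆-trans (select-⊆ m members) members⊆) (chosen⇒δ-chosen m)) ⟩
    k * ∣ δ-chosen m ∣P                           ≤⟨ k∣δ′∣≤ ⟩
    ∣⋃dom∣ δ″                                     ≤⟨ ⋃dom≤⋃domSize m δ″ δ″⊆ ⟩
    ⋃domSize (chosen m)                         ≡⟨ cong (⋃domSize ∘ select m) (cubes-constantDemand k members) ⟨
    ⋃domSize (select m (cubes family))          ∎
    where open ≤-Reasoning

  demand≤N : k * length members ≤ N
  demand≤N with δ″ , _ , _ , k∣δ∣≤ ← hn δ (λ _ δσ → δσ) = begin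
    k * length members        ≡⟨ cong (k *_) (count≡length-filterᵇ δ (allPartial N)) ⟨
    k * ∣ δ ∣P                 ≤⟨ k∣δ∣≤ ⟩
    ∣⋃dom∣ δ″                  ≤⟨ count≤length _ (allFin N) ⟩
    length (allFin N)          ≡⟨ length-tabulate id ⟩
    N                          ∎
    where open ≤-Reasoning

  avoiders≤∣A∣ : (A : TSet N) → (λ σ → σ ∈Δ A) ⪯ δ → avoiders (cubes family) ≤ ∣ A ∣T
  avoiders≤∣A∣ A Δ⪯δ = count-mono in-A (allTotal N)
    where
    in-A : ∀ f → avoidsAll (cubes family) f ≡ true → A f ≡ true
    in-A f avoids with A f in Af
    ... | true = refl
    ... | false with ρ , δρ , ρ⊑f ← MinimalCubes.outside-covered A δ Δ⪯δ f Af =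
      contradiction (trans (sym avoids) (cong not (∈⇒any _ ρ∈ (⊑⇒inCube ρ f ρ⊑f)))) λ ()
      where
      ρ∈ : ρ ∈ cubes family
      ρ∈ = subst (ρ ∈_) (sym (cubes-constantDemand k members)) (∈-filter⁺ (T? ∘ δ) (∈-allPartial ρ) (Equivalence.from T-≡ δρ))

mersenne≤2^ : ∀ k → mersenne k ≤ 2 ^ k
mersenne≤2^ k = ≤-trans (n≤1+n (mersenne k)) (≤-reflexive (suc-mersenne k))

powers-of-two-recombine : ∀ N k t u → (t + u) * k ≤ N → 2 ^ (N ∸ (t + u) * k) * (2 ^ k) ^ u * 2 ^ (t * k) ≡ 2 ^ N
powers-of-two-recombine N k t u fits = begin
    2 ^ R * (2 ^ k) ^ u * 2 ^ (t * k)   ≡⟨ cong (λ x → 2 ^ R * x * 2 ^ (t * k)) (trans (^-*-assoc 2 k u) (cong (2 ^_) (*-comm k u))) ⟩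
    2 ^ R * 2 ^ (u * k) * 2 ^ (t * k)   ≡⟨ cong (_* 2 ^ (t * k)) (^-distribˡ-+-* 2 R (u * k)) ⟨
    2 ^ (R + u * k) * 2 ^ (t * k)       ≡⟨ ^-distribˡ-+-* 2 (R + u * k) (t * k) ⟨
    2 ^ (R + u * k + t * k)             ≡⟨ cong (2 ^_) (trans (+-assoc R _ _) (cong (R +_) (trans (+-comm (u * k) _) (sym (*-distribʳ-+ k t u))))) ⟩
    2 ^ (R + (t + u) * k)               ≡⟨ cong (2 ^_) (m∸n+n≡m fits) ⟩
    2 ^ N                                ∎
  where
  open ≡-Reasoning
  R = N ∸ (t + u) * k

-- This is 2^N (1 − 2^−k)^(t+u) ≤ 2^N (1 − 2^−k)^t, with the denominators cleared.
mersenne-power-tradeoff : ∀ N k t u → (t + u) * k ≤ N →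
  2 ^ (N ∸ (t + u) * k) * mersenne k ^ (t + u) * 2 ^ (t * k) ≤ 2 ^ N * mersenne k ^ t
mersenne-power-tradeoff N k t u fits = begin
  2 ^ R * mersenne k ^ (t + u) * 2 ^ (t * k)              ≡⟨ cong (λ x → 2 ^ R * x * 2 ^ (t * k)) (^-distribˡ-+-* (mersenne k) t u) ⟩
  2 ^ R * (mersenne k ^ t * mersenne k ^ u) * 2 ^ (t * k) ≡⟨ rearrange (2 ^ R) (mersenne k ^ t) (mersenne k ^ u) (2 ^ (t * k)) ⟩
  2 ^ R * mersenne k ^ u * 2 ^ (t * k) * mersenne k ^ t   ≤⟨ *-monoˡ-≤ _ (*-monoˡ-≤ _ (*-monoʳ-≤ (2 ^ R) (^-monoˡ-≤ u (mersenne≤2^ k)))) ⟩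
  2 ^ R * (2 ^ k) ^ u * 2 ^ (t * k) * mersenne k ^ t      ≡⟨ cong (_* mersenne k ^ t) (powers-of-two-recombine N k t u fits) ⟩
  2 ^ N * mersenne k ^ t                                   ∎
  where
  open ≤-Reasoning
  R = N ∸ (t + u) * k
  rearrange : ∀ a x y c → a * (x * y) * c ≡ a * y * c * x
  rearrange = solve-∀

mersenne-power-antitone : ∀ N k t m → t ≤ m → m * k ≤ N →
  2 ^ (N ∸ m * k) * mersenne k ^ m * 2 ^ (t * k) ≤ 2 ^ N * mersenne k ^ t
mersenne-power-antitone N k t m t≤m fits =
  subst (λ n → 2 ^ (N ∸ n * k) * mersenne k ^ n * 2 ^ (t * k) ≤ 2 ^ N * mersenne k ^ t) (m+[n∸m]≡n t≤m)
        (mersenne-power-tradeoff N k t (m ∸ t) (subst (λ n → n * k ≤ N) (sym (m+[n∸m]≡n t≤m)) fits))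

norm4-lower-bound : ∀ N (A : TSet N) k (δ : PSet N) → (λ σ → σ ∈Δ A) ⪯ δ → HnCond δ (suc k) →
  let m = N / suc k in 2 ^ (N ∸ m * suc k) * mersenne (suc k) ^ m ≤ ∣ A ∣T
norm4-lower-bound N A k δ Δ⪯δ hn = *-cancelʳ-≤ _ _ (2 ^ (t * suc k)) {{>-nonZero (m^n>0 2 (t * suc k))}} (begin
  2 ^ (N ∸ m * suc k) * mersenne (suc k) ^ m * 2 ^ (t * suc k)       ≤⟨ mersenne-power-antitone N (suc k) t m t≤m (m/n*n≤m N (suc k)) ⟩
  2 ^ N * mersenne (suc k) ^ t                                         ≡⟨ cong (2 ^ N *_) (weight-constantDemand (suc k) members) ⟨
  2 ^ N * weight family                                                ≤⟨ avoiders-bound N family hall ⟩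
  avoiders (cubes family) * 2 ^ totalDemand family                     ≡⟨ cong (λ d → avoiders (cubes family) * 2 ^ d) demand ⟩
  avoiders (cubes family) * 2 ^ (t * suc k)                            ≤⟨ *-monoˡ-≤ _ (avoiders≤∣A∣ A Δ⪯δ) ⟩
  ∣ A ∣T * 2 ^ (t * suc k)                                             ∎)
  where
  open HnFamily δ (suc k) hn
  open ≤-Reasoning
  m = N / suc k
  t = length members
  t≤m : t ≤ m
  t≤m = ≤-trans (≤-reflexive (sym (m*n/n≡m t (suc k)))) (/-monoˡ-≤ (suc k) (≤-trans (≤-reflexive (*-comm t (suc k))) demand≤N))
  demand : totalDemand family ≡ t * suc k
  demand = trans (totalDemand-constantDemand (suc k) members) (*-comm (suc k) t)

mainTheorem19 : (N : ℕ) (A : TSet N) (k : ℕ) →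
    IsNorm4 A (suc k) → 1 < suc k →
    bound N k ℤ.≤ ℤ.+ ∣ A ∣T
mainTheorem19 N A zero _ (s≤s ())
mainTheorem19 N A (suc k) ((δ , Δ⪯δ , (k′ , _ , sk≡k′ , hn) , _) , _) _ =
  subst (ℤ._≤ ℤ.+ ∣ A ∣T) (sym (alternating-sum-closed-form N (suc k) (N / suc k) (m/n*n≤m N (suc k))))
        (ℤ.+≤+ (norm4-lower-bound N A k δ Δ⪯δ (subst (HnCond δ) (sym (suc-injective sk≡k′)) hn)))
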